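{- Let $(G,b)$ and $(H,c)$ be $\mathbb{Z}_2$-coloured graphs such that $(H,c)$ is a $\mathbb{Z}_2$-coloured graph minor of $(G,b)$. Then there is a surjective group homomorphism $\Gamma(G,b)\to\Gamma(H,c)$ sending $J_{G,b}\mapsto J_{H,c}$.
   Context: All graphs are finite; multiple edges between two vertices are allowed, loops are not. For a vertex $v$, $E(v)$ denotes the set of edges incident to $v$. A $\mathbb{Z}_2$-colouring of a graph $G$ is an arbitrary (not necessarily proper) function $b:V(G)\to\mathbb{Z}_2$; its parity is $\sum_{v\in V(G)}b(v)\in\mathbb{Z}_2$. The graph incidence group $\Gamma(G,b)$ is the group generated by $\{x_e:e\in E(G)\}\cup\{J\}$ subject to: $J^2=1$ and $x_e^2=1$ for all $e$; $[x_e,J]=1$ for all $e$; $[x_e,x_{e'}]=1$ whenever $e,e'\in E(v)$ for some vertex $v$; and $\prod_{e\in E(v)}x_e=J^{b(v)}$ for every vertex $v$. We write $J_{G,b}$ for the generator $J$ of $\Gamma(G,b)$. Here $[x,y]=xyx^{ -1}y^{ -1}$. The $\mathbb{Z}_2$-coloured minor operations are: (1) edge deletion: $(G,b)\mapsto(G\setminus e,b)$; (2) edge contraction: for an edge $e$ with endpoints $v_1,v_2$, $(G,b)\mapsto(G/e,b')$, where $G/e$ replaces $v_1,v_2$ by a new vertex $u$, removes all edges between $v_1$ and $v_2$, makes every other edge formerly incident to $v_1$ or $v_2$ incident to $u$, and $b'(u)=b(v_1)+b(v_2)$, $b'(v)=b(v)$ otherwise; (3) vertex deletion: for a vertex $v$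 with $b(v)=0$, delete $v$ and all edges incident to it, restricting $b$; (4) edge toggling: for an edge $e$, keep $G$ and add $1$ to $b(v)$ for both endpoints $v$ of $e$. $(H,c)$ is a $\mathbb{Z}_2$-coloured graph minor of $(G,b)$ if it can be obtained from $(G,b)$ by a finite sequence of these operations. -}

module Defs where

open import Level using (0ℓ)
open import Data.Nat using (ℕ; zero; suc)
open import Data.Fin using (Fin; punchOut; punchIn; _≟_)
open import Data.Bool using (Bool; true; false; _xor_; _∧_; _∨_; if_then_else_)
open import Data.List using (List; []; _∷_; length; lookup; mapMaybe; removeAt; filter; allFin; foldr)
open import Data.Product using (_×_; _,_; proj₁; proj₂; Σ)
open import Data.Sum using (_⊎_)
open import Data.Maybe using (Maybe; just; nothing)
open import Relation.Nullary using (yes; no)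
open import Relation.Nullary.Decidable using (⌊_⌋)
open import Relation.Binary.PropositionalEquality using (_≡_; _≢_; sym; isEquivalence)
open import Algebra.Bundles using (Group)
open import Function.Bundles using (_↔_; Inverse)

infixl 7 _·_
data Word (X : Set) : Set where
  gen : X → Word X
  ε   : Word X
  _·_ : Word X → Word X → Word X
  inv : Word X → Word X

comm : {X : Set} → Word X → Word X → Word X
comm a b = a · b · inv a · inv b

module Presentation (X : Set) (R : Word X → Word X → Set) where
  infix 4 _≈_
  data _≈_ : Word X → Word X → Set where
    refl≈   : ∀ {w} → w ≈ w
    sym≈    : ∀ {u w} → u ≈ w → w ≈ u
    trans≈  : ∀ {u v w} → u ≈ v → v ≈ w → u ≈ w
    ·-cong  : ∀ {u u' w w'} → u ≈ u' → w ≈ w' → u · w ≈ u' · w'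
    inv-cong : ∀ {u u'} → u ≈ u' → inv u ≈ inv u'
    assoc   : ∀ u v w → (u · v) · w ≈ u · (v · w)
    idˡ     : ∀ w → ε · w ≈ w
    idʳ     : ∀ w → w · ε ≈ w
    invˡ    : ∀ w → inv w · w ≈ ε
    invʳ    : ∀ w → w · inv w ≈ ε
    rel     : ∀ {u w} → R u w → u ≈ w

  group : Group 0ℓ 0ℓ
  group = record
    { Carrier = Word X
    ; _≈_ = _≈_
    ; _∙_ = _·_
    ; ε = ε
    ; _⁻¹ = inv
    ; isGroup = record
      { isMonoid = record
        { isSemigroup = record
          { isMagma = record
            { isEquivalence = record { refl = refl≈ ; sym = sym≈ ; trans = trans≈ }
            ; ∙-cong = ·-cong }
          ; assoc = assoc }
        ; identity = idˡ , idʳ }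
      ; inverse = invˡ , invʳ
      ; ⁻¹-cong = inv-cong }
    }

-- Graphs: vertices Fin nV, edges = a list of endpoint pairs
-- (edge e is the e-th entry; multiple edges allowed).

record Graph : Set where
  constructor mkGraph
  field
    nV    : ℕ
    edges : List (Fin nV × Fin nV)

  Vtx : Set
  Vtx = Fin nV

  Edge : Set
  Edge = Fin (length edges)

  ends : Edge → Vtx × Vtx
  ends e = lookup edges e

open Graph public

Loopless : Graph → Set
Loopless G = ∀ e → proj₁ (ends G e) ≢ proj₂ (ends G e)

-- Z₂ is represented by Bool, with addition _xor_
Colouring : Graph → Set
Colouring G = Vtx G → Bool

Incident : (G : Graph) → Vtx G → Edge G → Set
Incident G v e = proj₁ (ends G e) ≡ v ⊎ proj₂ (ends G e) ≡ v

incidentᵇ : (G : Graph) → Vtx G → Edge G → Bool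
incidentᵇ G v e = ⌊ proj₁ (ends G e) ≟ v ⌋ ∨ ⌊ proj₂ (ends G e) ≟ v ⌋

-- E(v) as a list of edges in increasing order
E : (G : Graph) → Vtx G → List (Edge G)
E G v = Data.List.filterᵇ (incidentᵇ G v) (allFin (length (edges G)))

data Gen (G : Graph) : Set where
  x : Edge G → Gen G
  J : Gen G

prodW : {G : Graph} → List (Edge G) → Word (Gen G)
prodW = foldr (λ e w → gen (x e) · w) ε

Jpow : {G : Graph} → Bool → Word (Gen G)
Jpow true  = gen J
Jpow false = ε

data Rel (G : Graph) (b : Colouring G) : Word (Gen G) → Word (Gen G) → Set where
  J²   : Rel G b (gen J · gen J) ε
  x²   : ∀ e → Rel G b (gen (x e) · gen (x e)) ε
  xJ   : ∀ e → Rel G b (comm (gen (x e)) (gen J)) ε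
  xx   : ∀ v e e' → Incident G v e → Incident G v e' →
         Rel G b (comm (gen (x e)) (gen (x e'))) ε
  vtx  : ∀ v → Rel G b (prodW (E G v)) (Jpow (b v))

Γ : (G : Graph) → Colouring G → Group 0ℓ 0ℓ
Γ G b = Presentation.group (Gen G) (Rel G b)

J[_,_] : (G : Graph) (b : Colouring G) → Group.Carrier (Γ G b)
J[ G , b ] = gen J

deleteEdge : (G : Graph) → Edge G → Graph
deleteEdge G e = mkGraph (nV G) (removeAt (edges G) e)

-- (2) edge contraction of an edge e with endpoints v₁ ≠ v₂ (v₁ = first, v₂ = second).
-- v₂ is removed, the merged vertex u sits at position punchOut (v₂ ≢ v₁),
-- all other vertices are renumbered by punchOut.
module Contract {n : ℕ} (es : List (Fin (suc n) × Fin (suc n)))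
                (e : Fin (length es))
                (ne : proj₁ (lookup es e) ≢ proj₂ (lookup es e)) where
  v₁ v₂ : Fin (suc n)
  v₁ = proj₁ (lookup es e)
  v₂ = proj₂ (lookup es e)

  u : Fin n
  u = punchOut {i = v₂} {j = v₁} (λ eq → ne (sym eq))

  collapse : Fin (suc n) → Fin n
  collapse w with w ≟ v₂
  ... | yes _ = u
  ... | no p  = punchOut {i = v₂} {j = w} (λ eq → p (sym eq))

  between : Fin (suc n) × Fin (suc n) → Bool
  between (a , c) = (⌊ a ≟ v₁ ⌋ ∧ ⌊ c ≟ v₂ ⌋) ∨ (⌊ a ≟ v₂ ⌋ ∧ ⌊ c ≟ v₁ ⌋)

  newEdge : Fin (suc n) × Fin (suc n) → Maybe (Fin n × Fin n)
  newEdge (a , c) = if between (a , c) then nothing else just (collapse a , collapse c)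

  graph : Graph
  graph = mkGraph n (mapMaybe newEdge es)

  colouring : (Fin (suc n) → Bool) → Colouring graph
  colouring b w = b (punchIn v₂ w) xor (⌊ w ≟ u ⌋ ∧ b v₂)

module DeleteVertex {n : ℕ} (es : List (Fin (suc n) × Fin (suc n))) (v : Fin (suc n)) where
  newEdge : Fin (suc n) × Fin (suc n) → Maybe (Fin n × Fin n)
  newEdge (a , c) with a ≟ v | c ≟ v
  ... | no p | no q = just (punchOut {i = v} {j = a} (λ eq → p (sym eq)) ,
                            punchOut {i = v} {j = c} (λ eq → q (sym eq)))
  ... | _    | _    = nothing

  graph : Graph
  graph = mkGraph n (mapMaybe newEdge es)

  colouring : (Fin (suc n) → Bool) → Colouring graph
  colouring b w = b (punchIn v w)

toggle : (G : Graph) → Colouring G → Edge G → Colouring G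
toggle G b e w = b w xor incidentᵇ G w e

-- Isomorphism of Z₂-coloured graphs (relabelling of vertices and edges;
-- edges are unordered, so endpoints may be swapped).
SameEnds : {n : ℕ} → Fin n × Fin n → Fin n × Fin n → Set
SameEnds (a , c) (a' , c') = (a ≡ a' × c ≡ c') ⊎ (a ≡ c' × c ≡ a')

record Iso (G : Graph) (b : Colouring G) (H : Graph) (c : Colouring H) : Set where
  field
    σ : Vtx G ↔ Vtx H
    τ : Edge G ↔ Edge H
    ends-ok : ∀ e → SameEnds (Inverse.to σ (proj₁ (ends G e)) , Inverse.to σ (proj₂ (ends G e)))
                             (ends H (Inverse.to τ e))
    colour-ok : ∀ v → c (Inverse.to σ v) ≡ b v

data Step : (G : Graph) → Colouring G → (H : Graph) → Colouring H → Set where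
  edge-deletion : ∀ G b (e : Edge G) → Step G b (deleteEdge G e) b
  edge-contraction : ∀ {n} (es : List (Fin (suc n) × Fin (suc n))) b e ne →
    Step (mkGraph (suc n) es) b (Contract.graph es e ne) (Contract.colouring es e ne b)
  vertex-deletion : ∀ {n} (es : List (Fin (suc n) × Fin (suc n))) b v → b v ≡ false →
    Step (mkGraph (suc n) es) b (DeleteVertex.graph es v) (DeleteVertex.colouring es v b)
  edge-toggling : ∀ G b (e : Edge G) → Step G b G (toggle G b e)
  isomorphism : ∀ G b H c → Iso G b H c → Step G b H c

data Minor : (G : Graph) → Colouring G → (H : Graph) → Colouring H → Set where
  done : ∀ G b → Minor G b G b
  step : ∀ {G b H c K d} → Step G b H c → Minor H c K d → Minor G b K d

-- Each minor operation is realised on generators, J ↦ J: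
-- deleting e sends x_e ↦ 1; toggling e sends x_e ↦ J x_e; deleting v (with b(v) = 0) sends
-- every edge at v to 1; relabelling relabels; contracting e = v₁v₂ sends x_e to the product
-- J^b(v₁) ∏_{f ∈ E(v₁)∖e} x_f dictated by the relation at v₁, and the relation at v₂ then becomes
-- the relation at the merged vertex. The images of edges at a common vertex v of G all lie in the
-- abelian subgroup generated by J and the edges at the image of v, which is what makes the
-- commutation relations hold, and every generator of the target is hit. Minors compose such maps.
module Submission where

open import Level using (0ℓ)
open import Data.Nat using (ℕ; zero; suc)
open import Data.Fin using (Fin; zero; suc; punchOut; punchIn; _≟_)
open import Data.Fin.Properties
  using (suc-injective; punchIn-punchOut; punchIn-injective; punchOut-cong; punchOut-injective)
open import Data.Bool using (Bool; true; false; _xor_; _∧_; _∨_; if_then_else_)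
open import Data.Bool.Properties using (∨-comm; ∨-commutativeMonoid)
open import Data.List using (List; []; _∷_; length; lookup; mapMaybe; removeAt; filterᵇ; foldr; tabulate)
open import Data.Maybe using (Maybe; just; nothing; maybe′)
import Data.Maybe as Maybe
open import Data.Maybe.Properties using (just-injective; maybe′-map)
open import Data.Product using (Σ; ∃; _×_; _,_; proj₁; proj₂)
open import Data.Sum using (_⊎_; inj₁; inj₂; [_,_]′) renaming (map to ⊎-map)
open import Data.Empty using (⊥; ⊥-elim)
open import Function using (_∘_; id)
open import Function.Bundles using (_↔_; Inverse)
open import Relation.Nullary using (Dec; yes; no; ¬_)
open import Relation.Nullary.Decidable using (⌊_⌋; isYes≗does; dec-true; dec-false)
open import Relation.Binary.PropositionalEquality using (_≡_; refl; _≢_; sym; trans; cong; cong₂; subst)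
open import Algebra.Bundles using (Group; CommutativeMonoid)
open import Algebra.Morphism.Structures using (IsGroupHomomorphism)
import Algebra.Morphism.Construct.Composition as Composition
import Algebra.Properties.CommutativeMonoid.Sum as MonoidSum
import Algebra.Properties.CommutativeSemigroup as CommutativeSemigroupProperties

open import Defs

-- removeAt-index es k i and mapMaybe-index F es i: the position of the i-th entry of es in the
-- shortened list, if it survives.
module _ {A : Set} where
  removeAt-index : (es : List A) (k : Fin (length es)) → Fin (length es) → Maybe (Fin (length (removeAt es k)))
  removeAt-index (a ∷ es) zero    zero    = nothing
  removeAt-index (a ∷ es) zero    (suc i) = just i
  removeAt-index (a ∷ es) (suc k) zero    = just zero
  removeAt-index (a ∷ es) (suc k) (suc i) = Maybe.map suc (removeAt-index es k i)

  lookup-removeAt-index : ∀ es k i j → removeAt-index es k i ≡ just j → lookup (removeAt es k) j ≡ lookup es i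
  lookup-removeAt-index (a ∷ es) zero    (suc i) j refl = refl
  lookup-removeAt-index (a ∷ es) (suc k) zero    zero refl = refl
  lookup-removeAt-index (a ∷ es) (suc k) (suc i) j p with removeAt-index es k i in eq
  lookup-removeAt-index (a ∷ es) (suc k) (suc i) .(suc j) refl | just j = lookup-removeAt-index es k i j eq

  removeAt-index-surjective : ∀ es k j → ∃ λ i → removeAt-index es k i ≡ just j
  removeAt-index-surjective (a ∷ es) zero    j       = suc j , refl
  removeAt-index-surjective (a ∷ es) (suc k) zero    = zero , refl
  removeAt-index-surjective (a ∷ es) (suc k) (suc j) with removeAt-index-surjective es k j
  ... | i , p = suc i , cong (Maybe.map suc) p

module _ {A B : Set} (F : A → Maybe B) where
  mapMaybe-index : (es : List A) → Fin (length es) → Maybe (Fin (length (mapMaybe F es)))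
  mapMaybe-index (a ∷ es) i with F a
  mapMaybe-index (a ∷ es) zero    | just _  = just zero
  mapMaybe-index (a ∷ es) (suc i) | just _  = Maybe.map suc (mapMaybe-index es i)
  mapMaybe-index (a ∷ es) zero    | nothing = nothing
  mapMaybe-index (a ∷ es) (suc i) | nothing = mapMaybe-index es i

  lookup-mapMaybe-index : ∀ es i j → mapMaybe-index es i ≡ just j →
    F (lookup es i) ≡ just (lookup (mapMaybe F es) j)
  lookup-mapMaybe-index (a ∷ es) zero j p with F a
  lookup-mapMaybe-index (a ∷ es) zero .zero refl | just _ = refl
  lookup-mapMaybe-index (a ∷ es) (suc i) j p with F a
  lookup-mapMaybe-index (a ∷ es) (suc i) j p | nothing = lookup-mapMaybe-index es i j p
  lookup-mapMaybe-index (a ∷ es) (suc i) j p | just _ with mapMaybe-index es i in eq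
  lookup-mapMaybe-index (a ∷ es) (suc i) .(suc j) refl | just _ | just j = lookup-mapMaybe-index es i j eq

  mapMaybe-index-surjective : ∀ es j → ∃ λ i → mapMaybe-index es i ≡ just j
  mapMaybe-index-surjective (a ∷ es) j with F a
  mapMaybe-index-surjective (a ∷ es) zero    | just _ = zero , refl
  mapMaybe-index-surjective (a ∷ es) (suc j) | just _ with mapMaybe-index-surjective es j
  ... | i , p = suc i , cong (Maybe.map suc) p
  mapMaybe-index-surjective (a ∷ es) j | nothing with mapMaybe-index-surjective es j
  ... | i , p = suc i , p

extend : {X Y : Set} → (X → Word Y) → Word X → Word Y
extend φ (gen a) = φ a
extend φ ε       = ε
extend φ (u · w) = extend φ u · extend φ w
extend φ (inv w) = inv (extend φ w)

∏ : {Y : Set} {n : ℕ} → (Fin n → Word Y) → Word Y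
∏ {n = zero}  t = ε
∏ {n = suc n} t = t zero · ∏ (t ∘ suc)

module PresentationProperties (Y : Set) (R : Word Y → Word Y → Set) where
  open Presentation Y R public

  infix 4 _⇄_
  _⇄_ : Word Y → Word Y → Set
  a ⇄ b = a · b ≈ b · a

  infixr 2 _⟨≈⟩_
  _⟨≈⟩_ : ∀ {a b c} → a ≈ b → b ≈ c → a ≈ c
  _⟨≈⟩_ = trans≈

  ≡⇒≈ : ∀ {a b} → a ≡ b → a ≈ b
  ≡⇒≈ refl = refl≈

  ·-congʳ : ∀ {a a' b} → a ≈ a' → a · b ≈ a' · b
  ·-congʳ p = ·-cong p refl≈

  ·-congˡ : ∀ {a b b'} → b ≈ b' → a · b ≈ a · b'
  ·-congˡ p = ·-cong refl≈ p

  assocʳ : ∀ {a b c} → (a · b) · c ≈ a · (b · c)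
  assocʳ = assoc _ _ _

  assocˡ : ∀ {a b c} → a · (b · c) ≈ (a · b) · c
  assocˡ = sym≈ assocʳ

  ·-inv-cancelʳ : ∀ a b → (a · b) · inv b ≈ a
  ·-inv-cancelʳ a b = assocʳ ⟨≈⟩ ·-congˡ (invʳ b) ⟨≈⟩ idʳ a

  inv-·-cancelʳ : ∀ a b → (a · inv b) · b ≈ a
  inv-·-cancelʳ a b = assocʳ ⟨≈⟩ ·-congˡ (invˡ b) ⟨≈⟩ idʳ a

  comm≈ε⇒⇄ : ∀ {a b} → comm a b ≈ ε → a ⇄ b
  comm≈ε⇒⇄ {a} {b} h =
    sym≈ (inv-·-cancelʳ (a · b) a) ⟨≈⟩ ·-congʳ (sym≈ (inv-·-cancelʳ ((a · b) · inv a) b))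
    ⟨≈⟩ ·-congʳ (·-congʳ h) ⟨≈⟩ ·-congʳ (idˡ b)

  ⇄⇒comm≈ε : ∀ {a b} → a ⇄ b → comm a b ≈ ε
  ⇄⇒comm≈ε {a} {b} h = ·-congʳ (·-congʳ h) ⟨≈⟩ ·-congʳ (·-inv-cancelʳ b a) ⟨≈⟩ invʳ b

  ⇄-sym : ∀ {a b} → a ⇄ b → b ⇄ a
  ⇄-sym = sym≈

  ≈ε-⇄ : ∀ {a b} → a ≈ ε → a ⇄ b
  ≈ε-⇄ {a} {b} p = ·-congʳ p ⟨≈⟩ idˡ b ⟨≈⟩ sym≈ (idʳ b) ⟨≈⟩ ·-congˡ (sym≈ p)

  ⇄-ε : ∀ {a} → a ⇄ ε
  ⇄-ε {a} = idʳ a ⟨≈⟩ sym≈ (idˡ a)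

  ⇄-· : ∀ {a b c} → a ⇄ b → a ⇄ c → a ⇄ b · c
  ⇄-· p q = assocˡ ⟨≈⟩ ·-congʳ p ⟨≈⟩ assocʳ ⟨≈⟩ ·-congˡ q ⟨≈⟩ assocˡ

  ·-⇄ : ∀ {a b c} → a ⇄ c → b ⇄ c → a · b ⇄ c
  ·-⇄ p q = ⇄-sym (⇄-· (⇄-sym p) (⇄-sym q))

  inv-⇄ : ∀ {a b} → a ⇄ b → inv a ⇄ b
  inv-⇄ {a} {b} p = sym≈ (·-inv-cancelʳ (inv a · b) a)
    ⟨≈⟩ ·-congʳ (assocʳ ⟨≈⟩ ·-congˡ (sym≈ p) ⟨≈⟩ assocˡ ⟨≈⟩ ·-congʳ (invˡ a) ⟨≈⟩ idˡ _)

  ∏-cong : ∀ {n} {t t' : Fin n → Word Y} → (∀ i → t i ≈ t' i) → ∏ t ≈ ∏ t'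
  ∏-cong {zero}  h = refl≈
  ∏-cong {suc n} h = ·-cong (h zero) (∏-cong (h ∘ suc))

  ∏-ε : ∀ {n} {t : Fin n → Word Y} → (∀ i → t i ≈ ε) → ∏ t ≈ ε
  ∏-ε {zero}  h = refl≈
  ∏-ε {suc n} h = ·-cong (h zero) (∏-ε (h ∘ suc)) ⟨≈⟩ idˡ ε

  ⇄-∏ : ∀ {n a} {t : Fin n → Word Y} → (∀ i → a ⇄ t i) → a ⇄ ∏ t
  ⇄-∏ {zero}  h = ⇄-ε
  ⇄-∏ {suc n} h = ⇄-· (h zero) (⇄-∏ (h ∘ suc))

  ∏-·-∏ : ∀ {n} (s t : Fin n → Word Y) → (∀ i j → t i ⇄ s j) →
    ∏ s · ∏ t ≈ ∏ (λ i → s i · t i)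
  ∏-·-∏ {zero}  s t h = idˡ ε
  ∏-·-∏ {suc n} s t h =
    assocʳ ⟨≈⟩ ·-congˡ (assocˡ ⟨≈⟩ ·-congʳ (⇄-sym (⇄-∏ (h zero ∘ suc))) ⟨≈⟩ assocʳ
      ⟨≈⟩ ·-congˡ (∏-·-∏ (s ∘ suc) (t ∘ suc) (λ i j → h (suc i) (suc j))))
    ⟨≈⟩ assocˡ

  ∏-insert : ∀ {n} (k : Fin n) (a : Word Y) (t t' : Fin n → Word Y) →
    (∀ i → a ⇄ t i) → (∀ i → i ≢ k → t' i ≈ t i) → t' k ≈ a · t k → ∏ t' ≈ a · ∏ t
  ∏-insert zero a t t' ha ht hk = ·-cong hk (∏-cong (λ i → ht (suc i) (λ ()))) ⟨≈⟩ assocʳ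
  ∏-insert (suc k) a t t' ha ht hk =
    ·-cong (ht zero (λ ()))
      (∏-insert k a (t ∘ suc) (t' ∘ suc) (ha ∘ suc) (λ i i≢k → ht (suc i) (i≢k ∘ suc-injective)) hk)
    ⟨≈⟩ assocˡ ⟨≈⟩ ·-congʳ (⇄-sym (ha zero)) ⟨≈⟩ assocʳ

  foldr-filter≈∏ : ∀ {n m} (g : Fin n → Fin m) (p : Fin m → Bool) (h : Fin m → Word Y) →
    foldr (λ i w → h i · w) ε (filterᵇ p (tabulate g)) ≈ ∏ (λ i → if p (g i) then h (g i) else ε)
  foldr-filter≈∏ {zero}  g p h = refl≈
  foldr-filter≈∏ {suc n} g p h with p (g zero)
  ... | true  = ·-congˡ (foldr-filter≈∏ (g ∘ suc) p h)
  ... | false = foldr-filter≈∏ (g ∘ suc) p h ⟨≈⟩ sym≈ (idˡ _)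

  if-ε-ε : ∀ p → (if p then ε else ε) ≈ ε
  if-ε-ε true  = refl≈
  if-ε-ε false = refl≈

  ∏-removeAt : ∀ {A : Set} (es : List A) k
    (t : Fin (length es) → Word Y) (t' : Fin (length (removeAt es k)) → Word Y) →
    (∀ i → t i ≈ maybe′ t' ε (removeAt-index es k i)) → ∏ t ≈ ∏ t'
  ∏-removeAt (a ∷ es) zero t t' h = ·-congʳ (h zero) ⟨≈⟩ idˡ _ ⟨≈⟩ ∏-cong (h ∘ suc)
  ∏-removeAt (a ∷ es) (suc k) t t' h =
    ·-cong (h zero) (∏-removeAt es k (t ∘ suc) (t' ∘ suc)
      (λ i → h (suc i) ⟨≈⟩ ≡⇒≈ (maybe′-map t' ε suc (removeAt-index es k i))))

  ∏-mapMaybe : ∀ {A B : Set} (F : A → Maybe B) es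
    (t : Fin (length es) → Word Y) (t' : Fin (length (mapMaybe F es)) → Word Y) →
    (∀ i → t i ≈ maybe′ t' ε (mapMaybe-index F es i)) → ∏ t ≈ ∏ t'
  ∏-mapMaybe F []       t t' h = refl≈
  ∏-mapMaybe F (a ∷ es) t t' h with F a
  ... | just _ = ·-cong (h zero) (∏-mapMaybe F es (t ∘ suc) (t' ∘ suc)
    (λ i → h (suc i) ⟨≈⟩ ≡⇒≈ (maybe′-map t' ε suc (mapMaybe-index F es i))))
  ... | nothing = ·-congʳ (h zero) ⟨≈⟩ idˡ _ ⟨≈⟩ ∏-mapMaybe F es (t ∘ suc) t' (h ∘ suc)

  if-·-if : ∀ p q a → p ∧ q ≡ false →
    (if p then a else ε) · (if q then a else ε) ≈ (if p ∨ q then a else ε)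
  if-·-if true  true  a ()
  if-·-if true  false a _ = idʳ a
  if-·-if false true  a _ = idˡ a
  if-·-if false false a _ = idˡ ε

extend-prodW : ∀ {G : Graph} {Y : Set} (φ : Gen G → Word Y) (l : List (Edge G)) →
  extend φ (prodW l) ≡ foldr (λ e w → φ (x e) · w) ε l
extend-prodW φ []      = refl
extend-prodW φ (e ∷ l) = cong (φ (x e) ·_) (extend-prodW φ l)

xor-false : ∀ p → p xor false ≡ p
xor-false true  = refl
xor-false false = refl

⌊⌋≡true : ∀ {A : Set} (a? : Dec A) → A → ⌊ a? ⌋ ≡ true
⌊⌋≡true a? a = trans (isYes≗does a?) (dec-true a? a)

⌊⌋≡false : ∀ {A : Set} (a? : Dec A) → ¬ A → ⌊ a? ⌋ ≡ false
⌊⌋≡false a? ¬a = trans (isYes≗does a?) (dec-false a? ¬a)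

incidentᵇ⇒Incident : ∀ (G : Graph) v e → incidentᵇ G v e ≡ true → Incident G v e
incidentᵇ⇒Incident G v e h with proj₁ (ends G e) ≟ v | proj₂ (ends G e) ≟ v | h
... | yes p | _     | _ = inj₁ p
... | no _  | yes q | _ = inj₂ q

Incident⇒incidentᵇ : ∀ (G : Graph) v e → Incident G v e → incidentᵇ G v e ≡ true
Incident⇒incidentᵇ G v e (inj₁ p) rewrite ⌊⌋≡true (proj₁ (ends G e) ≟ v) p = refl
Incident⇒incidentᵇ G v e (inj₂ q) rewrite ⌊⌋≡true (proj₂ (ends G e) ≟ v) q = ∨-comm _ true

⌊≟⌋-cong : ∀ {n m} (a v : Fin n) (a' v' : Fin m) → (a ≡ v → a' ≡ v') → (a' ≡ v' → a ≡ v) →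
  ⌊ a ≟ v ⌋ ≡ ⌊ a' ≟ v' ⌋
⌊≟⌋-cong a v a' v' f g with a ≟ v | a' ≟ v'
... | yes _ | yes _ = refl
... | no _  | no _  = refl
... | yes p | no q  = ⊥-elim (q (f p))
... | no p  | yes q = ⊥-elim (p (g q))

module IncidenceGroup (H : Graph) (c : Colouring H) where
  open PresentationProperties (Gen H) (Rel H c) public

  ⇄-J : ∀ w → w ⇄ gen J
  ⇄-J (gen (x f)) = comm≈ε⇒⇄ (rel (xJ f))
  ⇄-J (gen J)     = refl≈
  ⇄-J ε           = ⇄-sym ⇄-ε
  ⇄-J (u · w)     = ·-⇄ (⇄-J u) (⇄-J w)
  ⇄-J (inv w)     = inv-⇄ (⇄-J w)

  data Local (u : Vtx H) : Word (Gen H) → Set where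
    J-local : Local u (gen J)
    x-local : ∀ f → incidentᵇ H u f ≡ true → Local u (gen (x f))
    ε-local : Local u ε
    ·-local : ∀ {a b} → Local u a → Local u b → Local u (a · b)

  local-⇄ : ∀ {u a b} → Local u a → Local u b → a ⇄ b
  local-⇄ la          (·-local p q) = ⇄-· (local-⇄ la p) (local-⇄ la q)
  local-⇄ la          ε-local       = ⇄-ε
  local-⇄ (·-local p q) lb          = ·-⇄ (local-⇄ p lb) (local-⇄ q lb)
  local-⇄ ε-local     lb            = ⇄-sym ⇄-ε
  local-⇄ J-local     J-local       = refl≈
  local-⇄ J-local     (x-local f _) = ⇄-sym (⇄-J _)
  local-⇄ (x-local f _) J-local     = ⇄-J _
  local-⇄ {u} (x-local f p) (x-local f' q) =
    comm≈ε⇒⇄ (rel (xx u f f' (incidentᵇ⇒Incident H u f p) (incidentᵇ⇒Incident H u f' q)))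

  local-involutive : ∀ {u a} → Local u a → a · a ≈ ε
  local-involutive J-local       = rel J²
  local-involutive (x-local f _) = rel (x² f)
  local-involutive ε-local       = idˡ ε
  local-involutive (·-local p q) =
    assocʳ ⟨≈⟩ ·-congˡ (assocˡ ⟨≈⟩ ·-congʳ (local-⇄ q p) ⟨≈⟩ assocʳ
      ⟨≈⟩ ·-congˡ (local-involutive q) ⟨≈⟩ idʳ _)
    ⟨≈⟩ local-involutive p

  ∏-local : ∀ {u n} {t : Fin n → Word (Gen H)} → (∀ i → Local u (t i)) → Local u (∏ t)
  ∏-local {n = zero}  h = ε-local
  ∏-local {n = suc n} h = ·-local (h zero) (∏-local (h ∘ suc))

  Jpow-local : ∀ {u} p → Local u (Jpow p)
  Jpow-local true  = J-local
  Jpow-local false = ε-local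

  Jpow-cong : ∀ {p q} → p ≡ q → Jpow p ≈ Jpow q
  Jpow-cong refl = refl≈

  Jpow-·-xor : ∀ p q → Jpow p · Jpow (p xor q) ≈ Jpow q
  Jpow-·-xor true  true  = idʳ _
  Jpow-·-xor true  false = rel J²
  Jpow-·-xor false q     = idˡ _

  edgeTerm : Vtx H → Edge H → Word (Gen H)
  edgeTerm u f = if incidentᵇ H u f then gen (x f) else ε

  edgeTerm-local : ∀ u f → Local u (edgeTerm u f)
  edgeTerm-local u f with incidentᵇ H u f in eq
  ... | true  = x-local f eq
  ... | false = ε-local

  vertex-relation : ∀ u → ∏ (edgeTerm u) ≈ Jpow (c u)
  vertex-relation u = sym≈ (foldr-filter≈∏ id (incidentᵇ H u) (gen ∘ x)) ⟨≈⟩ rel (vtx u)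

JEpimorphism : (G : Graph) → Colouring G → (H : Graph) → Colouring H → Set
JEpimorphism G b H c = Σ (Group.Carrier (Γ G b) → Group.Carrier (Γ H c)) (λ f →
  IsGroupHomomorphism (Group.rawGroup (Γ G b)) (Group.rawGroup (Γ H c)) f
  × (∀ y → ∃ (λ w → Group._≈_ (Γ H c) (f w) y))
  × Group._≈_ (Γ H c) (f J[ G , b ]) J[ H , c ])

JEpimorphism-id : ∀ G b → JEpimorphism G b G b
JEpimorphism-id G b = id , record
  { isMonoidHomomorphism = record
    { isMagmaHomomorphism = record
      { isRelHomomorphism = record { cong = id }
      ; homo = λ _ _ → refl≈ }
    ; ε-homo = refl≈ }
  ; ⁻¹-homo = λ _ → refl≈ } , (λ y → y , refl≈) , refl≈
  where open Presentation (Gen G) (Rel G b)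

JEpimorphism-∘ : ∀ {G b H c K d} → JEpimorphism G b H c → JEpimorphism H c K d → JEpimorphism G b K d
JEpimorphism-∘ {K = K} {d} (f , f-hom , f-surj , f-J) (g , g-hom , g-surj , g-J) =
  g ∘ f , Composition.isGroupHomomorphism trans≈ f-hom g-hom , surj , trans≈ (⟦⟧-cong f-J) g-J
  where
    open Presentation (Gen K) (Rel K d)
    open IsGroupHomomorphism g-hom using (⟦⟧-cong)
    surj : ∀ y → ∃ λ w → g (f w) ≈ y
    surj y with g-surj y
    ... | w₂ , gw₂≈y with f-surj w₂
    ... | w₁ , fw₁≈w₂ = w₁ , trans≈ (⟦⟧-cong fw₁≈w₂) gw₂≈y

module FromEdgeImages (G : Graph) (b : Colouring G) (H : Graph) (c : Colouring H)
               (image : Edge G → Word (Gen H)) where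
  open IncidenceGroup H c
  private module ΓG = Presentation (Gen G) (Rel G b)

  onGen : Gen G → Word (Gen H)
  onGen (x e) = image e
  onGen J     = gen J

  map : Word (Gen G) → Word (Gen H)
  map = extend onGen

  imageTerm : Vtx G → Edge G → Word (Gen H)
  imageTerm v e = if incidentᵇ G v e then image e else ε

  map-Jpow : ∀ p → map (Jpow p) ≡ Jpow p
  map-Jpow true  = refl
  map-Jpow false = refl

  module _ (involutive : ∀ e → image e · image e ≈ ε)
           (adjacent-⇄ : ∀ v e e' → Incident G v e → Incident G v e' → image e ⇄ image e')
           (vertex-relation-holds : ∀ v → ∏ (imageTerm v) ≈ Jpow (b v))
           (edges-in-image : ∀ f → ∃ λ w → map w ≈ gen (x f)) where

    map-rel : ∀ {u w} → Rel G b u w → map u ≈ map w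
    map-rel J²              = rel J²
    map-rel (x² e)          = involutive e
    map-rel (xJ e)          = ⇄⇒comm≈ε (⇄-J (image e))
    map-rel (xx v e e' p q) = ⇄⇒comm≈ε (adjacent-⇄ v e e' p q)
    map-rel (vtx v) =
      ≡⇒≈ (extend-prodW onGen (E G v)) ⟨≈⟩ foldr-filter≈∏ id (incidentᵇ G v) image
      ⟨≈⟩ vertex-relation-holds v ⟨≈⟩ ≡⇒≈ (sym (map-Jpow (b v)))

    map-cong : ∀ {u w} → u ΓG.≈ w → map u ≈ map w
    map-cong ΓG.refl≈         = refl≈
    map-cong (ΓG.sym≈ p)      = sym≈ (map-cong p)
    map-cong (ΓG.trans≈ p q)  = trans≈ (map-cong p) (map-cong q)
    map-cong (ΓG.·-cong p q)  = ·-cong (map-cong p) (map-cong q)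
    map-cong (ΓG.inv-cong p)  = inv-cong (map-cong p)
    map-cong (ΓG.assoc u v w) = assoc _ _ _
    map-cong (ΓG.idˡ w)       = idˡ _
    map-cong (ΓG.idʳ w)       = idʳ _
    map-cong (ΓG.invˡ w)      = invˡ _
    map-cong (ΓG.invʳ w)      = invʳ _
    map-cong (ΓG.rel r)       = map-rel r

    map-surjective : ∀ y → ∃ λ w → map w ≈ y
    map-surjective (gen (x f)) = edges-in-image f
    map-surjective (gen J)     = gen J , refl≈
    map-surjective ε           = ε , refl≈
    map-surjective (u · w) with map-surjective u | map-surjective w
    ... | u' , p | w' , q = u' · w' , ·-cong p q
    map-surjective (inv w) with map-surjective w
    ... | w' , p = inv w' , inv-cong p

    epimorphism : JEpimorphism G b H c
    epimorphism = map , record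
      { isMonoidHomomorphism = record
        { isMagmaHomomorphism = record
          { isRelHomomorphism = record { cong = map-cong }
          ; homo = λ _ _ → refl≈ }
        ; ε-homo = refl≈ }
      ; ⁻¹-homo = λ _ → refl≈ } , map-surjective , refl≈

module Toggling (G : Graph) (b : Colouring G) (e₀ : Edge G) where
  open IncidenceGroup G (toggle G b e₀)

  image : Edge G → Word (Gen G)
  image e with e ≟ e₀
  ... | yes _ = gen J · gen (x e)
  ... | no _  = gen (x e)

  open FromEdgeImages G b G (toggle G b e₀) image using (imageTerm; map; epimorphism)

  image-e₀ : image e₀ ≡ gen J · gen (x e₀)
  image-e₀ with e₀ ≟ e₀
  ... | yes _ = refl
  ... | no e₀≢e₀ = ⊥-elim (e₀≢e₀ refl)

  image-≢ : ∀ e → e ≢ e₀ → image e ≡ gen (x e)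
  image-≢ e e≢e₀ with e ≟ e₀
  ... | yes e≡e₀ = ⊥-elim (e≢e₀ e≡e₀)
  ... | no _     = refl

  image-local : ∀ v e → Incident G v e → Local v (image e)
  image-local v e inc with e ≟ e₀
  ... | yes _ = ·-local J-local (x-local e (Incident⇒incidentᵇ G v e inc))
  ... | no _  = x-local e (Incident⇒incidentᵇ G v e inc)

  imageTerm-≢ : ∀ v e → e ≢ e₀ → imageTerm v e ≈ edgeTerm v e
  imageTerm-≢ v e e≢e₀ rewrite image-≢ e e≢e₀ = refl≈

  imageTerm-e₀-incident : ∀ v → incidentᵇ G v e₀ ≡ true → imageTerm v e₀ ≈ gen J · edgeTerm v e₀
  imageTerm-e₀-incident v inc rewrite inc | image-e₀ = refl≈

  imageTerm-e₀-nonincident : ∀ v → incidentᵇ G v e₀ ≡ false → imageTerm v e₀ ≈ edgeTerm v e₀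
  imageTerm-e₀-nonincident v ¬inc rewrite ¬inc = refl≈

  vertex-relation-holds : ∀ v → ∏ (imageTerm v) ≈ Jpow (b v)
  vertex-relation-holds v with incidentᵇ G v e₀ in inc
  ... | true =
    ∏-insert e₀ (gen J) (edgeTerm v) (imageTerm v) (λ _ → ⇄-sym (⇄-J _)) (imageTerm-≢ v)
      (imageTerm-e₀-incident v inc)
    ⟨≈⟩ ·-congˡ (vertex-relation v ⟨≈⟩ Jpow-cong (cong (b v xor_) inc)) ⟨≈⟩ J-·-flip (b v)
    where
      J-·-flip : ∀ p → gen J · Jpow (p xor true) ≈ Jpow p
      J-·-flip true  = idʳ _
      J-·-flip false = rel J²
  ... | false =
    ∏-cong imageTerm≈edgeTerm ⟨≈⟩ vertex-relation v ⟨≈⟩ Jpow-cong (cong (b v xor_) inc)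
    ⟨≈⟩ Jpow-cong (xor-false (b v))
    where
      imageTerm≈edgeTerm : ∀ e → imageTerm v e ≈ edgeTerm v e
      imageTerm≈edgeTerm e = by-cases (e ≟ e₀)
        where
          by-cases : Dec (e ≡ e₀) → imageTerm v e ≈ edgeTerm v e
          by-cases (yes e≡e₀) =
            subst (λ e → imageTerm v e ≈ edgeTerm v e) (sym e≡e₀) (imageTerm-e₀-nonincident v inc)
          by-cases (no e≢e₀) = imageTerm-≢ v e e≢e₀

  edges-in-image : ∀ f → ∃ λ w → map w ≈ gen (x f)
  edges-in-image f with f ≟ e₀
  ... | yes f≡e₀ = gen J · gen (x e₀) ,
    (·-congˡ (≡⇒≈ image-e₀) ⟨≈⟩ assocˡ ⟨≈⟩ ·-congʳ (rel J²) ⟨≈⟩ idˡ _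
      ⟨≈⟩ ≡⇒≈ (cong (gen ∘ x) (sym f≡e₀)))
  ... | no f≢e₀ = gen (x f) , ≡⇒≈ (image-≢ f f≢e₀)

  result : JEpimorphism G b G (toggle G b e₀)
  result = epimorphism
    (λ e → local-involutive (image-local _ e (inj₁ refl)))
    (λ v e e' p q → local-⇄ (image-local v e p) (image-local v e' q))
    vertex-relation-holds edges-in-image

-- The local words at a vertex form a commutative monoid, so their products may be permuted.
module LocalMonoid (H : Graph) (c : Colouring H) (u : Vtx H) where
  open IncidenceGroup H c

  commutativeMonoid : CommutativeMonoid 0ℓ 0ℓ
  commutativeMonoid = record
    { Carrier = Σ (Word (Gen H)) (Local u)
    ; _≈_ = λ p q → proj₁ p ≈ proj₁ q
    ; _∙_ = λ p q → proj₁ p · proj₁ q , ·-local (proj₂ p) (proj₂ q)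
    ; ε = ε , ε-local
    ; isCommutativeMonoid = record
      { isMonoid = record
        { isSemigroup = record
          { isMagma = record
            { isEquivalence = record { refl = refl≈ ; sym = sym≈ ; trans = trans≈ }
            ; ∙-cong = ·-cong }
          ; assoc = λ _ _ _ → assocʳ }
        ; identity = (λ _ → idˡ _) , (λ _ → idʳ _) }
      ; comm = λ p q → local-⇄ (proj₂ p) (proj₂ q) }
    }

  open MonoidSum commutativeMonoid using (sum; sum-permute)

  sum≡∏ : ∀ {n} (t : Fin n → Σ (Word (Gen H)) (Local u)) → proj₁ (sum t) ≡ ∏ (proj₁ ∘ t)
  sum≡∏ {zero}  t = refl
  sum≡∏ {suc n} t = cong (proj₁ (t zero) ·_) (sum≡∏ (t ∘ suc))

  ∏-permute : ∀ {m n} (t : Fin n → Word (Gen H)) → (∀ i → Local u (t i)) → (π : Fin m ↔ Fin n) →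
    ∏ t ≈ ∏ (t ∘ Inverse.to π)
  ∏-permute t t-local π =
    ≡⇒≈ (sym (sum≡∏ t')) ⟨≈⟩ sum-permute t' π ⟨≈⟩ ≡⇒≈ (sum≡∏ (t' ∘ Inverse.to π))
    where t' = λ i → t i , t-local i

module Relabelling (G : Graph) (b : Colouring G) (H : Graph) (c : Colouring H) (I : Iso G b H c) where
  open Iso I
  open IncidenceGroup H c

  σ→ = Inverse.to σ
  τ→ = Inverse.to τ

  σ-injective : ∀ {v w} → σ→ v ≡ σ→ w → v ≡ w
  σ-injective {v} {w} p = trans (sym (Inverse.strictlyInverseʳ σ v))
    (trans (cong (Inverse.from σ) p) (Inverse.strictlyInverseʳ σ w))

  ⌊≟⌋-σ : ∀ {a'} a v → σ→ a ≡ a' → ⌊ a ≟ v ⌋ ≡ ⌊ a' ≟ σ→ v ⌋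
  ⌊≟⌋-σ a v p =
    ⌊≟⌋-cong a v _ (σ→ v) (λ a≡v → trans (sym p) (cong σ→ a≡v)) (σ-injective ∘ trans p)

  incidentᵇ-relabel : ∀ v e → incidentᵇ G v e ≡ incidentᵇ H (σ→ v) (τ→ e)
  incidentᵇ-relabel v e with ends G e | ends-ok e
  ... | a , a' | inj₁ (p , q) = cong₂ _∨_ (⌊≟⌋-σ a v p) (⌊≟⌋-σ a' v q)
  ... | a , a' | inj₂ (p , q) = trans (cong₂ _∨_ (⌊≟⌋-σ a v p) (⌊≟⌋-σ a' v q))
    (∨-comm ⌊ proj₂ (ends H (τ→ e)) ≟ σ→ v ⌋ ⌊ proj₁ (ends H (τ→ e)) ≟ σ→ v ⌋)

  image : Edge G → Word (Gen H)
  image e = gen (x (τ→ e))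

  open FromEdgeImages G b H c image using (imageTerm; epimorphism)

  image-local : ∀ v e → Incident G v e → Local (σ→ v) (image e)
  image-local v e inc = x-local (τ→ e) (trans (sym (incidentᵇ-relabel v e)) (Incident⇒incidentᵇ G v e inc))

  vertex-relation-holds : ∀ v → ∏ (imageTerm v) ≈ Jpow (b v)
  vertex-relation-holds v =
    ∏-cong imageTerm≈edgeTerm
    ⟨≈⟩ sym≈ (LocalMonoid.∏-permute H c (σ→ v) (edgeTerm (σ→ v)) (edgeTerm-local (σ→ v)) τ)
    ⟨≈⟩ vertex-relation (σ→ v) ⟨≈⟩ Jpow-cong (colour-ok v)
    where
      imageTerm≈edgeTerm : ∀ e → imageTerm v e ≈ edgeTerm (σ→ v) (τ→ e)
      imageTerm≈edgeTerm e rewrite incidentᵇ-relabel v e = refl≈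

  result : JEpimorphism G b H c
  result = epimorphism
    (λ e → rel (x² (τ→ e)))
    (λ v e e' p q → local-⇄ (image-local v e p) (image-local v e' q))
    vertex-relation-holds
    (λ f → gen (x (Inverse.from τ f)) , ≡⇒≈ (cong (gen ∘ x) (Inverse.strictlyInverseˡ τ f)))

module Reindexing (G : Graph) (b : Colouring G) (H : Graph) (c : Colouring H)
                  (ρ : Edge G → Maybe (Edge H)) (κ : Vtx H → Vtx G)
                  (incidentᵇ-ρ : ∀ w e f → ρ e ≡ just f → incidentᵇ G (κ w) e ≡ incidentᵇ H w f) where
  open IncidenceGroup H c

  image : Edge G → Word (Gen H)
  image e = maybe′ (gen ∘ x) ε (ρ e)

  open FromEdgeImages G b H c image public using (imageTerm; map; epimorphism)

  image-involutive : ∀ e → image e · image e ≈ ε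
  image-involutive e with ρ e
  ... | just f  = rel (x² f)
  ... | nothing = idˡ ε

  image-local : ∀ w e → incidentᵇ G (κ w) e ≡ true → Local w (image e)
  image-local w e inc with ρ e in eq
  ... | just f  = x-local f (trans (sym (incidentᵇ-ρ w e f eq)) inc)
  ... | nothing = ε-local

  imageTerm-κ : ∀ w e → imageTerm (κ w) e ≈ maybe′ (edgeTerm w) ε (ρ e)
  imageTerm-κ w e with ρ e in eq
  ... | just f rewrite incidentᵇ-ρ w e f eq = refl≈
  ... | nothing = if-ε-ε (incidentᵇ G (κ w) e)

  edges-in-image : (∀ f → ∃ λ e → ρ e ≡ just f) → ∀ f → ∃ λ w → map w ≈ gen (x f)
  edges-in-image ρ-surjective f with ρ-surjective f
  ... | e , ρe≡f = gen (x e) , ≡⇒≈ (cong (maybe′ (gen ∘ x) ε) ρe≡f)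

module EdgeDeletion (G : Graph) (b : Colouring G) (e₀ : Edge G) where
  H = deleteEdge G e₀
  ρ = removeAt-index (edges G) e₀
  open IncidenceGroup H b

  incidentᵇ-ρ : ∀ v e f → ρ e ≡ just f → incidentᵇ G v e ≡ incidentᵇ H v f
  incidentᵇ-ρ v e f p rewrite lookup-removeAt-index (edges G) e₀ e f p = refl

  open Reindexing G b H b ρ id incidentᵇ-ρ

  result : JEpimorphism G b H b
  result = epimorphism
    image-involutive
    (λ v e e' p q → local-⇄ (image-local v e (Incident⇒incidentᵇ G v e p))
                            (image-local v e' (Incident⇒incidentᵇ G v e' q)))
    (λ v → ∏-removeAt (edges G) e₀ (imageTerm v) (edgeTerm v) (imageTerm-κ v) ⟨≈⟩ vertex-relation v)
    (edges-in-image (removeAt-index-surjective (edges G) e₀))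

module VertexDeletion {n : ℕ} (es : List (Fin (suc n) × Fin (suc n))) (b : Fin (suc n) → Bool)
                      (v₀ : Fin (suc n)) (b-v₀ : b v₀ ≡ false) where
  G = mkGraph (suc n) es
  H = DeleteVertex.graph es v₀
  c = DeleteVertex.colouring es v₀ b
  newEdge = DeleteVertex.newEdge es v₀
  ρ = mapMaybe-index newEdge es
  open IncidenceGroup H c

  newEdge-just : ∀ a a' y y' → newEdge (a , a') ≡ just (y , y') →
    a ≢ v₀ × a' ≢ v₀ × punchIn v₀ y ≡ a × punchIn v₀ y' ≡ a'
  newEdge-just a a' y y' eq with a ≟ v₀ | a' ≟ v₀
  newEdge-just a a' y y' eq | no a≢v₀ | no a'≢v₀ with just-injective eq
  ... | refl = a≢v₀ , a'≢v₀ , punchIn-punchOut _ , punchIn-punchOut _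
  newEdge-just a a' y y' () | yes _ | _
  newEdge-just a a' y y' () | no _  | yes _

  ⌊≟⌋-punchIn : ∀ {a y} w → punchIn v₀ y ≡ a → ⌊ a ≟ punchIn v₀ w ⌋ ≡ ⌊ y ≟ w ⌋
  ⌊≟⌋-punchIn {a} {y} w p =
    ⌊≟⌋-cong a (punchIn v₀ w) y w
      (punchIn-injective v₀ y w ∘ trans p) (λ y≡w → trans (sym p) (cong (punchIn v₀) y≡w))

  incidentᵇ-ρ : ∀ w e f → ρ e ≡ just f → incidentᵇ G (punchIn v₀ w) e ≡ incidentᵇ H w f
  incidentᵇ-ρ w e f p with ends G e | ends H f | lookup-mapMaybe-index newEdge es e f p
  ... | a , a' | y , y' | eq with newEdge-just a a' y y' eq
  ... | _ , _ , pa , pa' = cong₂ _∨_ (⌊≟⌋-punchIn w pa) (⌊≟⌋-punchIn w pa')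

  incidentᵇ-v₀ : ∀ e f → ρ e ≡ just f → incidentᵇ G v₀ e ≡ false
  incidentᵇ-v₀ e f p with ends G e | ends H f | lookup-mapMaybe-index newEdge es e f p
  ... | a , a' | y , y' | eq with newEdge-just a a' y y' eq
  ... | a≢v₀ , a'≢v₀ , _ , _ =
    cong₂ _∨_ (⌊⌋≡false (a ≟ v₀) a≢v₀) (⌊⌋≡false (a' ≟ v₀) a'≢v₀)

  open Reindexing G b H c ρ (punchIn v₀) incidentᵇ-ρ

  image-at-v₀ : ∀ e → incidentᵇ G v₀ e ≡ true → image e ≈ ε
  image-at-v₀ e inc with ρ e in eq
  ... | nothing = refl≈
  ... | just f with trans (sym inc) (incidentᵇ-v₀ e f eq)
  ... | ()

  imageTerm-v₀ : ∀ e → imageTerm v₀ e ≈ ε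
  imageTerm-v₀ e with ρ e in eq
  ... | just f rewrite incidentᵇ-v₀ e f eq = refl≈
  ... | nothing = if-ε-ε (incidentᵇ G v₀ e)

  punchIn-punchOut-v : ∀ {v} (v≢v₀ : v ≢ v₀) → punchIn v₀ (punchOut (v≢v₀ ∘ sym)) ≡ v
  punchIn-punchOut-v v≢v₀ = punchIn-punchOut (v≢v₀ ∘ sym)

  vertex-relation-holds : ∀ v → ∏ (imageTerm v) ≈ Jpow (b v)
  vertex-relation-holds v with v ≟ v₀
  ... | yes refl = ∏-ε imageTerm-v₀ ⟨≈⟩ Jpow-cong (sym b-v₀)
  ... | no v≢v₀ = subst (λ v → ∏ (imageTerm v) ≈ Jpow (b v)) (punchIn-punchOut-v v≢v₀)
    (∏-mapMaybe newEdge es _ (edgeTerm w) (imageTerm-κ w) ⟨≈⟩ vertex-relation w)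
    where w = punchOut (v≢v₀ ∘ sym)

  adjacent-⇄ : ∀ v e e' → Incident G v e → Incident G v e' → image e ⇄ image e'
  adjacent-⇄ v e e' p q with v ≟ v₀
  ... | yes refl = ≈ε-⇄ (image-at-v₀ e (Incident⇒incidentᵇ G v₀ e p))
  ... | no v≢v₀ = local-⇄ (image-local w e (inc p)) (image-local w e' (inc q))
    where
      w = punchOut (v≢v₀ ∘ sym)
      inc : ∀ {e} → Incident G v e → incidentᵇ G (punchIn v₀ w) e ≡ true
      inc {e} r =
        subst (λ u → incidentᵇ G u e ≡ true) (sym (punchIn-punchOut-v v≢v₀)) (Incident⇒incidentᵇ G v e r)

  result : JEpimorphism G b H c
  result = epimorphism image-involutive adjacent-⇄ vertex-relation-holds
    (edges-in-image (mapMaybe-index-surjective newEdge es))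

⌊≟⌋-cong-∨ : ∀ {m k} (y z : Fin m) (a p q : Fin k) →
  (y ≡ z → a ≡ p ⊎ a ≡ q) → (a ≡ p → y ≡ z) → (a ≡ q → y ≡ z) →
  ⌊ y ≟ z ⌋ ≡ ⌊ a ≟ p ⌋ ∨ ⌊ a ≟ q ⌋
⌊≟⌋-cong-∨ y z a p q f g h with y ≟ z | a ≟ p | a ≟ q
... | yes _   | yes _   | _       = refl
... | yes _   | no _    | yes _   = refl
... | yes y≡z | no a≢p  | no a≢q  = ⊥-elim ([ a≢p , a≢q ]′ (f y≡z))
... | no y≢z  | yes a≡p | _       = ⊥-elim (y≢z (g a≡p))
... | no y≢z  | no _    | yes a≡q = ⊥-elim (y≢z (h a≡q))
... | no _    | no _    | no _    = refl

module Contraction {n : ℕ} (es : List (Fin (suc n) × Fin (suc n))) (e : Fin (length es))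
                   (v₁≢v₂ : proj₁ (lookup es e) ≢ proj₂ (lookup es e)) (b : Fin (suc n) → Bool) where
  open Contract es e v₁≢v₂ using (v₁; v₂; u; collapse; between; newEdge)
  G = mkGraph (suc n) es
  H = Contract.graph es e v₁≢v₂
  c = Contract.colouring es e v₁≢v₂ b
  ρ = mapMaybe-index newEdge es
  open IncidenceGroup H c

  collapse-v₁ : collapse v₁ ≡ u
  collapse-v₁ with v₁ ≟ v₂
  ... | yes _ = refl
  ... | no _  = punchOut-cong v₂ refl

  collapse-v₂ : collapse v₂ ≡ u
  collapse-v₂ with v₂ ≟ v₂
  ... | yes _     = refl
  ... | no v₂≢v₂ = ⊥-elim (v₂≢v₂ refl)

  collapse≡u : ∀ a → collapse a ≡ u → a ≡ v₁ ⊎ a ≡ v₂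
  collapse≡u a eq with a ≟ v₂
  ... | yes a≡v₂ = inj₂ a≡v₂
  ... | no a≢v₂  = inj₁ (punchOut-injective (a≢v₂ ∘ sym) (v₁≢v₂ ∘ sym) eq)

  collapse-injective-off : ∀ a w → w ≢ v₁ → w ≢ v₂ → collapse a ≡ collapse w → a ≡ w
  collapse-injective-off a w w≢v₁ w≢v₂ eq with w ≟ v₂
  ... | yes w≡v₂ = ⊥-elim (w≢v₂ w≡v₂)
  ... | no _ with a ≟ v₂
  ...   | yes _    = ⊥-elim (w≢v₁ (sym (punchOut-injective (v₁≢v₂ ∘ sym) (w≢v₂ ∘ sym) eq)))
  ...   | no a≢v₂  = punchOut-injective (a≢v₂ ∘ sym) (w≢v₂ ∘ sym) eq

  punchIn-collapse : ∀ w → w ≢ v₂ → punchIn v₂ (collapse w) ≡ w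
  punchIn-collapse w w≢v₂ with w ≟ v₂
  ... | yes w≡v₂ = ⊥-elim (w≢v₂ w≡v₂)
  ... | no _     = punchIn-punchOut _

  ⌊collapse≟u⌋ : ∀ a → ⌊ collapse a ≟ u ⌋ ≡ ⌊ a ≟ v₁ ⌋ ∨ ⌊ a ≟ v₂ ⌋
  ⌊collapse≟u⌋ a = ⌊≟⌋-cong-∨ (collapse a) u a v₁ v₂ (collapse≡u a)
    (λ a≡v₁ → trans (cong collapse a≡v₁) collapse-v₁)
    (λ a≡v₂ → trans (cong collapse a≡v₂) collapse-v₂)

  ⌊collapse≟collapse⌋ : ∀ a w → w ≢ v₁ → w ≢ v₂ → ⌊ a ≟ w ⌋ ≡ ⌊ collapse a ≟ collapse w ⌋
  ⌊collapse≟collapse⌋ a w w≢v₁ w≢v₂ =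
    ⌊≟⌋-cong a w (collapse a) (collapse w) (cong collapse) (collapse-injective-off a w w≢v₁ w≢v₂)

  between-v₁v₂ : between (v₁ , v₂) ≡ true
  between-v₁v₂ rewrite ⌊⌋≡true (v₁ ≟ v₁) refl | ⌊⌋≡true (v₂ ≟ v₂) refl = refl

  between-v₂v₁ : between (v₂ , v₁) ≡ true
  between-v₂v₁ rewrite ⌊⌋≡true (v₁ ≟ v₁) refl | ⌊⌋≡true (v₂ ≟ v₂) refl = ∨-comm _ true

  newEdge-just : ∀ a a' y y' → newEdge (a , a') ≡ just (y , y') →
    between (a , a') ≡ false × collapse a ≡ y × collapse a' ≡ y'
  newEdge-just a a' y y' eq with between (a , a')
  newEdge-just a a' y y' () | true
  newEdge-just a a' y y' eq | false with just-injective eq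
  ... | refl = refl , refl , refl

  ρ-e : ρ e ≡ nothing
  ρ-e with ρ e in eq
  ... | nothing = refl
  ... | just f with lookup-mapMaybe-index newEdge es e f eq
  ... | newEdge-e rewrite between-v₁v₂ with newEdge-e
  ... | ()

  module _ {i f} (ρi≡f : ρ i ≡ just f) where
    private
      ends-ρ : newEdge (ends G i) ≡ just (ends H f)
      ends-ρ = lookup-mapMaybe-index newEdge es i f ρi≡f

    incidentᵇ-off : ∀ w → w ≢ v₁ → w ≢ v₂ → incidentᵇ G w i ≡ incidentᵇ H (collapse w) f
    incidentᵇ-off w w≢v₁ w≢v₂ with ends G i | ends H f | ends-ρ
    ... | a , a' | y , y' | eq with newEdge-just a a' y y' eq
    ... | _ , refl , refl =
      cong₂ _∨_ (⌊collapse≟collapse⌋ a w w≢v₁ w≢v₂) (⌊collapse≟collapse⌋ a' w w≢v₁ w≢v₂)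

    incidentᵇ-u : incidentᵇ H u f ≡ incidentᵇ G v₁ i ∨ incidentᵇ G v₂ i
    incidentᵇ-u with ends G i | ends H f | ends-ρ
    ... | a , a' | y , y' | eq with newEdge-just a a' y y' eq
    ... | _ , refl , refl =
      trans (cong₂ _∨_ (⌊collapse≟u⌋ a) (⌊collapse≟u⌋ a'))
        (interchange ⌊ a ≟ v₁ ⌋ ⌊ a ≟ v₂ ⌋ ⌊ a' ≟ v₁ ⌋ ⌊ a' ≟ v₂ ⌋)
      where
        open CommutativeSemigroupProperties (CommutativeMonoid.commutativeSemigroup ∨-commutativeMonoid)
          using (interchange)

    incident-collapse : ∀ {v} → Incident G v i → Incident H (collapse v) f
    incident-collapse inc with ends G i | ends H f | ends-ρ
    ... | a , a' | y , y' | eq with newEdge-just a a' y y' eq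
    ... | _ , refl , refl = ⊎-map (cong collapse) (cong collapse) inc

    not-incident-both : Incident G v₁ i → Incident G v₂ i → ⊥
    not-incident-both p q with ends G i | ends H f | ends-ρ
    ... | a , a' | y , y' | eq with newEdge-just a a' y y' eq
    ... | not-between , _ , _ = joins p q
      where
        no-v₁v₂ : a ≡ v₁ → a' ≡ v₂ → ⊥
        no-v₁v₂ refl refl with trans (sym not-between) between-v₁v₂
        ... | ()
        no-v₂v₁ : a ≡ v₂ → a' ≡ v₁ → ⊥
        no-v₂v₁ refl refl with trans (sym not-between) between-v₂v₁
        ... | ()
        joins : a ≡ v₁ ⊎ a' ≡ v₁ → a ≡ v₂ ⊎ a' ≡ v₂ → ⊥
        joins (inj₁ p) (inj₁ q) = v₁≢v₂ (trans (sym p) q)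
        joins (inj₁ p) (inj₂ q) = no-v₁v₂ p q
        joins (inj₂ p) (inj₁ q) = no-v₂v₁ q p
        joins (inj₂ p) (inj₂ q) = v₁≢v₂ (trans (sym p) q)

    incident-v₁∧v₂ : incidentᵇ G v₁ i ∧ incidentᵇ G v₂ i ≡ false
    incident-v₁∧v₂ with incidentᵇ G v₁ i in p | incidentᵇ G v₂ i in q
    ... | true  | true  =
      ⊥-elim (not-incident-both (incidentᵇ⇒Incident G v₁ i p) (incidentᵇ⇒Incident G v₂ i q))
    ... | true  | false = refl
    ... | false | _     = refl

  image₀ : Edge G → Word (Gen H)
  image₀ i = maybe′ (gen ∘ x) ε (ρ i)

  imageTerm₀ : Vtx G → Edge G → Word (Gen H)
  imageTerm₀ v i = if incidentᵇ G v i then image₀ i else ε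

  -- The relation at v₁ in Γ(G,b) forces x_e = J^b(v₁) ∏_{f ∈ E(v₁), f ≠ e} x_f.
  image-e : Word (Gen H)
  image-e = Jpow (b v₁) · ∏ (imageTerm₀ v₁)

  image : Edge G → Word (Gen H)
  image i with i ≟ e
  ... | yes _ = image-e
  ... | no _  = image₀ i

  open FromEdgeImages G b H c image using (imageTerm; map; epimorphism)

  image-at-e : image e ≡ image-e
  image-at-e with e ≟ e
  ... | yes _   = refl
  ... | no e≢e = ⊥-elim (e≢e refl)

  image-≢ : ∀ i → i ≢ e → image i ≡ image₀ i
  image-≢ i i≢e with i ≟ e
  ... | yes i≡e = ⊥-elim (i≢e i≡e)
  ... | no _    = refl

  local-at : ∀ {w w' a} → w ≡ w' → Local w a → Local w' a
  local-at refl l = l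

  collapse-endpoint : ∀ {v} → proj₁ (ends G e) ≡ v ⊎ proj₂ (ends G e) ≡ v → collapse v ≡ u
  collapse-endpoint (inj₁ refl) = collapse-v₁
  collapse-endpoint (inj₂ refl) = collapse-v₂

  image₀-local : ∀ v i → Incident G v i → Local (collapse v) (image₀ i)
  image₀-local v i inc with ρ i in eq
  ... | nothing = ε-local
  ... | just f  = x-local f (Incident⇒incidentᵇ H (collapse v) f (incident-collapse eq inc))

  imageTerm₀-local : ∀ v i → Local (collapse v) (imageTerm₀ v i)
  imageTerm₀-local v i with incidentᵇ G v i in inc
  ... | true  = image₀-local v i (incidentᵇ⇒Incident G v i inc)
  ... | false = ε-local

  image-e-local : Local u image-e
  image-e-local = ·-local (Jpow-local (b v₁)) (∏-local (local-at collapse-v₁ ∘ imageTerm₀-local v₁))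

  image-local : ∀ v i → Incident G v i → Local (collapse v) (image i)
  image-local v i inc with i ≟ e
  ... | yes refl = local-at (sym (collapse-endpoint inc)) image-e-local
  ... | no _     = image₀-local v i inc

  imageTerm-≢ : ∀ v i → i ≢ e → imageTerm v i ≈ imageTerm₀ v i
  imageTerm-≢ v i i≢e rewrite image-≢ i i≢e = refl≈

  imageTerm-e : ∀ v → incidentᵇ G v e ≡ true → imageTerm v e ≈ image-e · imageTerm₀ v e
  imageTerm-e v inc rewrite inc | image-at-e | ρ-e = sym≈ (idʳ image-e)

  ∏-imageTerm-endpoint : ∀ v (inc : Incident G v e) → ∏ (imageTerm v) ≈ image-e · ∏ (imageTerm₀ v)
  ∏-imageTerm-endpoint v inc =
    ∏-insert e image-e (imageTerm₀ v) (imageTerm v)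
      (λ i → local-⇄ image-e-local (local-at (collapse-endpoint inc) (imageTerm₀-local v i)))
      (imageTerm-≢ v) (imageTerm-e v (Incident⇒incidentᵇ G v e inc))

  c-u : c u ≡ b v₁ xor b v₂
  c-u rewrite ⌊⌋≡true (u ≟ u) refl = cong (_xor b v₂) (cong b (punchIn-punchOut _))

  c-off : ∀ v → v ≢ v₁ → v ≢ v₂ → c (collapse v) ≡ b v
  c-off v v≢v₁ v≢v₂
    rewrite punchIn-collapse v v≢v₂ | ⌊collapse≟u⌋ v
          | ⌊⌋≡false (v ≟ v₁) v≢v₁ | ⌊⌋≡false (v ≟ v₂) v≢v₂ =
    xor-false (b v)

  imageTerm₀-v₁·v₂ : ∀ i → imageTerm₀ v₁ i · imageTerm₀ v₂ i ≈ maybe′ (edgeTerm u) ε (ρ i)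
  imageTerm₀-v₁·v₂ i with ρ i in eq
  ... | nothing = ·-cong (if-ε-ε (incidentᵇ G v₁ i)) (if-ε-ε (incidentᵇ G v₂ i)) ⟨≈⟩ idˡ ε
  ... | just f rewrite incidentᵇ-u eq = if-·-if _ _ (gen (x f)) (incident-v₁∧v₂ eq)

  ∏-imageTerm₀-v₁·v₂ : ∏ (imageTerm₀ v₁) · ∏ (imageTerm₀ v₂) ≈ Jpow (b v₁ xor b v₂)
  ∏-imageTerm₀-v₁·v₂ =
    ∏-·-∏ (imageTerm₀ v₁) (imageTerm₀ v₂)
      (λ i j → local-⇄ (local-at collapse-v₂ (imageTerm₀-local v₂ i))
                       (local-at collapse-v₁ (imageTerm₀-local v₁ j)))
    ⟨≈⟩ ∏-mapMaybe newEdge es _ (edgeTerm u) imageTerm₀-v₁·v₂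
    ⟨≈⟩ vertex-relation u ⟨≈⟩ Jpow-cong c-u

  imageTerm-off : ∀ v → v ≢ v₁ → v ≢ v₂ →
    ∀ i → imageTerm v i ≈ maybe′ (edgeTerm (collapse v)) ε (ρ i)
  imageTerm-off v v≢v₁ v≢v₂ i = by-cases (i ≟ e) ⟨≈⟩ reindex
    where
      e-not-at-v : incidentᵇ G v e ≡ false
      e-not-at-v = cong₂ _∨_ (⌊⌋≡false (v₁ ≟ v) (v≢v₁ ∘ sym)) (⌊⌋≡false (v₂ ≟ v) (v≢v₂ ∘ sym))
      at-e : imageTerm v e ≈ imageTerm₀ v e
      at-e rewrite e-not-at-v = refl≈
      by-cases : Dec (i ≡ e) → imageTerm v i ≈ imageTerm₀ v i
      by-cases (yes i≡e) = subst (λ i → imageTerm v i ≈ imageTerm₀ v i) (sym i≡e) at-e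
      by-cases (no i≢e)  = imageTerm-≢ v i i≢e
      reindex : imageTerm₀ v i ≈ maybe′ (edgeTerm (collapse v)) ε (ρ i)
      reindex with ρ i in eq
      ... | just f rewrite incidentᵇ-off eq v v≢v₁ v≢v₂ = refl≈
      ... | nothing = if-ε-ε (incidentᵇ G v i)

  vertex-relation-holds : ∀ v → ∏ (imageTerm v) ≈ Jpow (b v)
  vertex-relation-holds v with v ≟ v₁ | v ≟ v₂
  ... | yes refl | _ =
    ∏-imageTerm-endpoint v₁ (inj₁ refl) ⟨≈⟩ assocʳ
    ⟨≈⟩ ·-congˡ (local-involutive (∏-local (local-at collapse-v₁ ∘ imageTerm₀-local v₁))) ⟨≈⟩ idʳ _
  ... | no _ | yes refl =
    ∏-imageTerm-endpoint v₂ (inj₂ refl) ⟨≈⟩ assocʳ ⟨≈⟩ ·-congˡ ∏-imageTerm₀-v₁·v₂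
    ⟨≈⟩ Jpow-·-xor (b v₁) (b v₂)
  ... | no v≢v₁ | no v≢v₂ =
    ∏-cong (imageTerm-off v v≢v₁ v≢v₂)
    ⟨≈⟩ ∏-mapMaybe newEdge es _ (edgeTerm (collapse v)) (λ _ → refl≈)
    ⟨≈⟩ vertex-relation (collapse v) ⟨≈⟩ Jpow-cong (c-off v v≢v₁ v≢v₂)

  edges-in-image : ∀ f → ∃ λ w → map w ≈ gen (x f)
  edges-in-image f with mapMaybe-index-surjective newEdge es f
  ... | i , ρi≡f with i ≟ e
  ...   | yes refl with trans (sym ρi≡f) ρ-e
  ...     | ()
  edges-in-image f | i , ρi≡f | no i≢e =
    gen (x i) , ≡⇒≈ (trans (image-≢ i i≢e) (cong (maybe′ (gen ∘ x) ε) ρi≡f))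

  result : JEpimorphism G b H c
  result = epimorphism
    (λ i → local-involutive (image-local _ i (inj₁ refl)))
    (λ v i i' p q → local-⇄ (image-local v i p) (image-local v i' q))
    vertex-relation-holds edges-in-image

step-epimorphism : ∀ {G b H c} → Step G b H c → JEpimorphism G b H c
step-epimorphism (edge-deletion G b e)           = EdgeDeletion.result G b e
step-epimorphism (edge-contraction es b e v₁≢v₂) = Contraction.result es e v₁≢v₂ b
step-epimorphism (vertex-deletion es b v b-v≡0)  = VertexDeletion.result es b v b-v≡0
step-epimorphism (edge-toggling G b e)           = Toggling.result G b e
step-epimorphism (isomorphism G b H c I)         = Relabelling.result G b H c I

minor-epimorphism : ∀ {G b H c} → Minor G b H c → JEpimorphism G b H c
minor-epimorphism (done G b)   = JEpimorphism-id G b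
minor-epimorphism (step s m) = JEpimorphism-∘ (step-epimorphism s) (minor-epimorphism m)

lemma1p2 : (G : Graph) (b : Colouring G) (H : Graph) (c : Colouring H) →
    Loopless G → Loopless H → Minor G b H c →
    Σ (Group.Carrier (Γ G b) → Group.Carrier (Γ H c)) (λ f →
      IsGroupHomomorphism (Group.rawGroup (Γ G b)) (Group.rawGroup (Γ H c)) f
      × (∀ y → ∃ (λ w → Group._≈_ (Γ H c) (f w) y))
      × Group._≈_ (Γ H c) (f J[ G , b ]) J[ H , c ])
lemma1p2 G b H c _ _ = minor-epimorphism
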